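{- Let $(\mathbb{A},\mathcal{A})$ and $(\mathbb{B},\mathcal{B})$ be Boolean kits. Define $(\mathcal{A}\multimap\mathcal{B})(a,b)$, for $a\in\mathbb{A}$, $b\in\mathbb{B}$, as the set of all subgroups $H\le\mathrm{End}_{\mathbb{A}^{op}\times\mathbb{B}}(a,b)$ such that for all $(\alpha,\beta)\in H$: $\alpha\in\bigcup\mathcal{A}(a)$ implies $\beta\in\bigcup\mathcal{B}(b)$, and $\beta\in\bigcup\mathcal{B}^\perp(b)$ implies $\alpha\in\bigcup\mathcal{A}^\perp(a)$. Then $(\mathbb{A}^{op}\times\mathbb{B},\mathcal{A}\multimap\mathcal{B})$ is a Boolean kit.
   Context: A kit on a groupoid $\mathbb{A}$ is a family $\mathcal{A}(a)$ of sets of subgroups of $\mathrm{End}(a)=\mathbb{A}(a,a)$ closed under conjugation by morphisms of $\mathbb{A}$. Subgroups $H,K$ of $\mathrm{End}(a)$ (the endomorphism group in $\mathbb{A}^{op}$ having the same underlying set) are orthogonal if $H\cap K=\{\mathrm{id}_a\}$; $\mathcal{A}^\perp$ is the kit on $\mathbb{A}^{op}$ with $\mathcal{A}^\perp(a)$ the set of subgroups orthogonal to all members of $\mathcal{A}(a)$. A kit is Boolean if $\mathcal{A}=\mathcal{A}^{\perp\perp}$. $\bigcup\mathcal{A}(a)$ is the union of the members of $\mathcal{A}(a)$. -}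

module Defs where

open import Level using (0ℓ)
open import Data.Product using (Σ; Σ-syntax; _×_; _,_; proj₁; proj₂)
open import Function.Bundles using (_⇔_)
open import Relation.Binary.PropositionalEquality using (_≡_)

-- The operations of a groupoid (objects, hom-sets, identity, composition,
-- inverse).  Kits, subgroups, orthogonality only depend on these.
record GpdOps : Set₁ where
  field
    Obj  : Set
    Hom  : Obj → Obj → Set
    id   : ∀ {a} → Hom a a
    _∘_  : ∀ {a b c} → Hom b c → Hom a b → Hom a c
    _⁻¹  : ∀ {a b} → Hom a b → Hom b a

record IsGroupoid (G : GpdOps) : Set where
  open GpdOps G
  field
    assoc : ∀ {a b c d} (h : Hom c d) (g : Hom b c) (f : Hom a b) →
            (h ∘ g) ∘ f ≡ h ∘ (g ∘ f)
    idˡ   : ∀ {a b} (f : Hom a b) → id ∘ f ≡ f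
    idʳ   : ∀ {a b} (f : Hom a b) → f ∘ id ≡ f
    invˡ  : ∀ {a b} (f : Hom a b) → (f ⁻¹) ∘ f ≡ id
    invʳ  : ∀ {a b} (f : Hom a b) → f ∘ (f ⁻¹) ≡ id

record Groupoid : Set₁ where
  field
    ops        : GpdOps
    isGroupoid : IsGroupoid ops

op : GpdOps → GpdOps
op G = record
  { Obj = Obj
  ; Hom = λ a b → Hom b a
  ; id  = id
  ; _∘_ = λ f g → g ∘ f
  ; _⁻¹ = _⁻¹
  }
  where open GpdOps G

_⊗_ : GpdOps → GpdOps → GpdOps
A ⊗ B = record
  { Obj = A.Obj × B.Obj
  ; Hom = λ x y → A.Hom (proj₁ x) (proj₁ y) × B.Hom (proj₂ x) (proj₂ y)
  ; id  = A.id , B.id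
  ; _∘_ = λ f g → (proj₁ f A.∘ proj₁ g) , (proj₂ f B.∘ proj₂ g)
  ; _⁻¹ = λ f → (proj₁ f A.⁻¹) , (proj₂ f B.⁻¹)
  }
  where
    module A = GpdOps A
    module B = GpdOps B

module _ (G : GpdOps) where
  open GpdOps G

  End : Obj → Set
  End a = Hom a a

  record IsSubgroup (a : Obj) (H : End a → Set) : Set where
    field
      id∈ : H id
      ∘∈  : ∀ {g h} → H g → H h → H (g ∘ h)
      ⁻¹∈ : ∀ {g} → H g → H (g ⁻¹)

  Subgroup : Obj → Set₁
  Subgroup a = Σ[ H ∈ (End a → Set) ] IsSubgroup a H

  KitPred : Set₂
  KitPred = (a : Obj) → Subgroup a → Set₁

  -- Closure under conjugation: for f : a → b and H ∈ 𝒜(a), the conjugate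
  -- subgroup f H f⁻¹ = { g | f⁻¹ ∘ g ∘ f ∈ H } of End(b) belongs to 𝒜(b).
  IsKit : KitPred → Set₁
  IsKit 𝒜 = ∀ {a b} (f : Hom a b) (H : Subgroup a) → 𝒜 a H →
            Σ[ K ∈ Subgroup b ] (𝒜 b K ×
              (∀ (g : End b) → proj₁ K g ⇔ proj₁ H ((f ⁻¹) ∘ (g ∘ f))))

  ⋃ : KitPred → (a : Obj) → End a → Set₁
  ⋃ 𝒜 a g = Σ[ H ∈ Subgroup a ] (𝒜 a H × proj₁ H g)

  Orthogonal : {a : Obj} → (End a → Set) → (End a → Set) → Set
  Orthogonal {a} H K = ∀ (g : End a) → H g → K g → g ≡ id

_⊥ : {G : GpdOps} → KitPred G → KitPred (op G)
_⊥ {G} 𝒜 a K = ∀ (H : Subgroup G a) → 𝒜 a H → Orthogonal G (proj₁ H) (proj₁ K)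

IsBoolean : {G : GpdOps} → KitPred G → Set₁
IsBoolean {G} 𝒜 = ∀ (a : GpdOps.Obj G) (H : Subgroup G a) → 𝒜 a H ⇔ ((𝒜 ⊥) ⊥) a H

IsBooleanKit : {G : GpdOps} → KitPred G → Set₁
IsBooleanKit {G} 𝒜 = IsKit G 𝒜 × IsBoolean 𝒜

_⊸_ : {A B : GpdOps} → KitPred A → KitPred B → KitPred (op A ⊗ B)
_⊸_ {A} {B} 𝒜 ℬ (a , b) H =
  ∀ (α : End A a) (β : End B b) → proj₁ H (α , β) →
    ((⋃ A 𝒜 a α → ⋃ B ℬ b β) × (⋃ (op B) (ℬ ⊥) b β → ⋃ (op A) (𝒜 ⊥) a α))

-- Conjugation in End(a , b) of 𝔸ᵒᵖ × 𝔹 acts componentwise, so 𝒜 ⊸ ℬ inherits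
-- closure under conjugation from 𝒜, ℬ and their orthogonals.
-- For Booleanness, every product K × L with K ∈ 𝒜(a) and L ∈ ℬ⊥(b) lies in
-- (𝒜 ⊸ ℬ)⊥.  So if H ∈ (𝒜 ⊸ ℬ)⊥⊥, (α , β) ∈ H and α ∈ K ∈ 𝒜(a), then the
-- second projection of H ∩ (K × End b) meets every L ∈ ℬ⊥(b) trivially, hence
-- lies in ℬ⊥⊥(b) = ℬ(b), and it contains β.  Dually the first projection of
-- H ∩ (End a × L) lies in 𝒜⊥(a) outright.
module Submission where

open import Defs
open import Data.Product using (_×_; Σ-syntax; _,_; proj₁; proj₂)
open import Function.Bundles using (Equivalence; mk⇔)
open import Function.Properties.Equivalence using () renaming (refl to ⇔-refl)
open import Relation.Binary.PropositionalEquality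
  using (_≡_; sym; trans; cong; cong₂; subst; module ≡-Reasoning)

op-isGroupoid : {G : GpdOps} → IsGroupoid G → IsGroupoid (op G)
op-isGroupoid isGroupoid = record
  { assoc = λ h g f → sym (assoc f g h)
  ; idˡ   = idʳ
  ; idʳ   = idˡ
  ; invˡ  = invʳ
  ; invʳ  = invˡ
  }
  where open IsGroupoid isGroupoid

⊗-isGroupoid : {A B : GpdOps} → IsGroupoid A → IsGroupoid B → IsGroupoid (A ⊗ B)
⊗-isGroupoid isA isB = record
  { assoc = λ h g f → cong₂ _,_ (A.assoc _ _ _) (B.assoc _ _ _)
  ; idˡ   = λ f → cong₂ _,_ (A.idˡ _) (B.idˡ _)
  ; idʳ   = λ f → cong₂ _,_ (A.idʳ _) (B.idʳ _)
  ; invˡ  = λ f → cong₂ _,_ (A.invˡ _) (B.invˡ _)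
  ; invʳ  = λ f → cong₂ _,_ (A.invʳ _) (B.invʳ _)
  }
  where
    module A = IsGroupoid isA
    module B = IsGroupoid isB

module Conjugation {G : GpdOps} (isGroupoid : IsGroupoid G) where
  open GpdOps G renaming (id to 1#)
  open IsGroupoid isGroupoid
  open ≡-Reasoning

  ⁻¹-∘-cancelˡ : ∀ {a b c} (f : Hom a b) (g : Hom c a) → (f ⁻¹) ∘ (f ∘ g) ≡ g
  ⁻¹-∘-cancelˡ f g = begin
    (f ⁻¹) ∘ (f ∘ g)   ≡⟨ sym (assoc _ _ _) ⟩
    ((f ⁻¹) ∘ f) ∘ g   ≡⟨ cong (_∘ g) (invˡ f) ⟩
    1# ∘ g             ≡⟨ idˡ g ⟩
    g                  ∎

  ∘-⁻¹-cancelˡ : ∀ {a b c} (f : Hom a b) (g : Hom c b) → f ∘ ((f ⁻¹) ∘ g) ≡ g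
  ∘-⁻¹-cancelˡ f g = begin
    f ∘ ((f ⁻¹) ∘ g)   ≡⟨ sym (assoc _ _ _) ⟩
    (f ∘ (f ⁻¹)) ∘ g   ≡⟨ cong (_∘ g) (invʳ f) ⟩
    1# ∘ g             ≡⟨ idˡ g ⟩
    g                  ∎

  ∘-⁻¹-cancelʳ : ∀ {a b c} (f : Hom a b) (g : Hom a c) → (g ∘ (f ⁻¹)) ∘ f ≡ g
  ∘-⁻¹-cancelʳ f g = begin
    (g ∘ (f ⁻¹)) ∘ f   ≡⟨ assoc _ _ _ ⟩
    g ∘ ((f ⁻¹) ∘ f)   ≡⟨ cong (g ∘_) (invˡ f) ⟩
    g ∘ 1#             ≡⟨ idʳ g ⟩
    g                  ∎

  ⁻¹-unique : ∀ {a b} (f : Hom a b) (g : Hom b a) → f ∘ g ≡ 1# → g ≡ f ⁻¹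
  ⁻¹-unique f g fg≡1 = begin
    g                  ≡⟨ sym (⁻¹-∘-cancelˡ f g) ⟩
    (f ⁻¹) ∘ (f ∘ g)   ≡⟨ cong ((f ⁻¹) ∘_) fg≡1 ⟩
    (f ⁻¹) ∘ 1#        ≡⟨ idʳ (f ⁻¹) ⟩
    f ⁻¹               ∎

  conj : ∀ {a b} → Hom a b → End G b → End G a
  conj f g = (f ⁻¹) ∘ (g ∘ f)

  conj-id : ∀ {a b} (f : Hom a b) → conj f 1# ≡ 1#
  conj-id f = trans (cong ((f ⁻¹) ∘_) (idˡ f)) (invˡ f)

  conj-∘ : ∀ {a b} (f : Hom a b) (g h : End G b) →
           conj f (g ∘ h) ≡ conj f g ∘ conj f h
  conj-∘ f g h = sym (begin
    ((f ⁻¹) ∘ (g ∘ f)) ∘ ((f ⁻¹) ∘ (h ∘ f))   ≡⟨ assoc _ _ _ ⟩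
    (f ⁻¹) ∘ ((g ∘ f) ∘ ((f ⁻¹) ∘ (h ∘ f)))   ≡⟨ cong ((f ⁻¹) ∘_) (assoc _ _ _) ⟩
    (f ⁻¹) ∘ (g ∘ (f ∘ ((f ⁻¹) ∘ (h ∘ f))))
      ≡⟨ cong (λ k → (f ⁻¹) ∘ (g ∘ k)) (∘-⁻¹-cancelˡ f (h ∘ f)) ⟩
    (f ⁻¹) ∘ (g ∘ (h ∘ f))                    ≡⟨ cong ((f ⁻¹) ∘_) (sym (assoc _ _ _)) ⟩
    (f ⁻¹) ∘ ((g ∘ h) ∘ f)                    ∎)

  conj-⁻¹ : ∀ {a b} (f : Hom a b) (g : End G b) → conj f (g ⁻¹) ≡ (conj f g) ⁻¹
  conj-⁻¹ f g = ⁻¹-unique (conj f g) (conj f (g ⁻¹)) (begin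
    conj f g ∘ conj f (g ⁻¹)   ≡⟨ sym (conj-∘ f g (g ⁻¹)) ⟩
    conj f (g ∘ (g ⁻¹))        ≡⟨ cong (conj f) (invʳ g) ⟩
    conj f 1#                  ≡⟨ conj-id f ⟩
    1#                         ∎)

  conj-cancel : ∀ {a b} (f : Hom a b) (g : End G a) → conj f ((f ∘ g) ∘ (f ⁻¹)) ≡ g
  conj-cancel f g =
    trans (cong ((f ⁻¹) ∘_) (∘-⁻¹-cancelʳ f (f ∘ g))) (⁻¹-∘-cancelˡ f g)

  conjSubgroup : ∀ {a b} → Hom a b → Subgroup G a → Subgroup G b
  conjSubgroup f (H , isH) = (λ g → H (conj f g)) , record
    { id∈ = subst H (sym (conj-id f)) id∈
    ; ∘∈  = λ {g} {h} g∈ h∈ → subst H (sym (conj-∘ f g h)) (∘∈ g∈ h∈)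
    ; ⁻¹∈ = λ {g} g∈ → subst H (sym (conj-⁻¹ f g)) (⁻¹∈ g∈)
    }
    where open IsSubgroup isH

  isKit-intro : {𝒜 : KitPred G} →
                (∀ {a b} (f : Hom a b) (H : Subgroup G a) →
                 𝒜 a H → 𝒜 b (conjSubgroup f H)) →
                IsKit G 𝒜
  isKit-intro conj-closed f H H∈ =
    conjSubgroup f H , conj-closed f H H∈ , λ _ → ⇔-refl

  ⋃-conj : {𝒜 : KitPred G} → IsKit G 𝒜 → ∀ {a b} (f : Hom a b) {g : End G b} →
           ⋃ G 𝒜 a (conj f g) → ⋃ G 𝒜 b g
  ⋃-conj kit f (H , H∈ , g∈H) =
    let (K , K∈ , K⇔conjH) = kit f H H∈
    in  K , K∈ , Equivalence.from (K⇔conjH _) g∈H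

  ⋃-conj⁻¹ : {𝒜 : KitPred G} → IsKit G 𝒜 → ∀ {a b} (f : Hom a b) {g : End G a} →
             ⋃ G 𝒜 a g → ⋃ G 𝒜 b ((f ∘ g) ∘ (f ⁻¹))
  ⋃-conj⁻¹ {𝒜} kit f {g} g∈⋃ =
    ⋃-conj kit f (subst (⋃ G 𝒜 _) (sym (conj-cancel f g)) g∈⋃)

⊥-isKit : {G : GpdOps} {𝒜 : KitPred G} → IsGroupoid G → IsKit G 𝒜 → IsKit (op G) (𝒜 ⊥)
⊥-isKit {G} {𝒜} isGroupoid kit = Op.isKit-intro conj-closed
  where
    open GpdOps G
    open Conjugation isGroupoid
    module Op = Conjugation (op-isGroupoid isGroupoid)
    open ≡-Reasoning

    conj-closed : ∀ {a b} (f : Hom b a) (K : Subgroup (op G) a) →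
                  (𝒜 ⊥) a K → (𝒜 ⊥) b (Op.conjSubgroup f K)
    conj-closed f K K⊥𝒜 H H∈ g g∈H g∈fKf⁻¹ =
      let (H′ , H′∈ , fgf⁻¹∈H′) = ⋃-conj⁻¹ kit f (H , H∈ , g∈H)
      in  begin
        g                          ≡⟨ sym (conj-cancel f g) ⟩
        conj f ((f ∘ g) ∘ (f ⁻¹))  ≡⟨ cong (conj f) (K⊥𝒜 H′ H′∈ _ fgf⁻¹∈H′ g∈fKf⁻¹) ⟩
        conj f id                  ≡⟨ conj-id f ⟩
        id                         ∎

⊸-isKit : {A B : GpdOps} {𝒜 : KitPred A} {ℬ : KitPred B} →
          IsGroupoid A → IsGroupoid B → IsKit A 𝒜 → IsKit B ℬ →
          IsKit (op A ⊗ B) (𝒜 ⊸ ℬ)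
⊸-isKit {A} {B} {𝒜} {ℬ} isA isB 𝒜-kit ℬ-kit = AᵒᵖB.isKit-intro conj-closed
  where
    module A   = Conjugation isA
    module B   = Conjugation isB
    module Aᵒᵖ = Conjugation (op-isGroupoid isA)
    module Bᵒᵖ = Conjugation (op-isGroupoid isB)
    module AᵒᵖB = Conjugation (⊗-isGroupoid (op-isGroupoid isA) isB)

    conj-closed : ∀ {x y} (f : GpdOps.Hom (op A ⊗ B) x y) H →
                  (𝒜 ⊸ ℬ) x H → (𝒜 ⊸ ℬ) y (AᵒᵖB.conjSubgroup f H)
    conj-closed (f₁ , f₂) H H∈ α β αβ∈ =
      let (forward , backward) = H∈ _ _ αβ∈
      in  (λ α∈ → B.⋃-conj ℬ-kit f₂ (forward (A.⋃-conj⁻¹ 𝒜-kit f₁ α∈)))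
        , (λ β∈ → Aᵒᵖ.⋃-conj (⊥-isKit isA 𝒜-kit) f₁
                    (backward (Bᵒᵖ.⋃-conj⁻¹ (⊥-isKit isB ℬ-kit) f₂ β∈)))

⊆-⊥⊥ : {G : GpdOps} (𝒜 : KitPred G) (a : GpdOps.Obj G) (H : Subgroup G a) →
       𝒜 a H → ((𝒜 ⊥) ⊥) a H
⊆-⊥⊥ 𝒜 a H H∈ K K⊥𝒜 g g∈K g∈H = K⊥𝒜 H H∈ g g∈H g∈K

opˢ : {G : GpdOps} {a : GpdOps.Obj G} → Subgroup G a → Subgroup (op G) a
opˢ (H , isH) = H , record { id∈ = id∈ ; ∘∈ = λ g∈ h∈ → ∘∈ h∈ g∈ ; ⁻¹∈ = ⁻¹∈ }
  where open IsSubgroup isH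

module _ {G₁ G₂ : GpdOps} {a : GpdOps.Obj G₁} {b : GpdOps.Obj G₂} where

  _×ˢ_ : Subgroup G₁ a → Subgroup G₂ b → Subgroup (G₁ ⊗ G₂) (a , b)
  (K , isK) ×ˢ (L , isL) = (λ (x , y) → K x × L y) , record
    { id∈ = K.id∈ , L.id∈
    ; ∘∈  = λ (x∈ , y∈) (x′∈ , y′∈) → K.∘∈ x∈ x′∈ , L.∘∈ y∈ y′∈
    ; ⁻¹∈ = λ (x∈ , y∈) → K.⁻¹∈ x∈ , L.⁻¹∈ y∈
    }
    where
      module K = IsSubgroup isK
      module L = IsSubgroup isL

  π₁ : Subgroup (G₁ ⊗ G₂) (a , b) → Subgroup G₂ b → Subgroup G₁ a
  π₁ (H , isH) (L , isL) = (λ x → Σ[ y ∈ End G₂ b ] (L y × H (x , y))) , record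
    { id∈ = _ , L.id∈ , H.id∈
    ; ∘∈  = λ (_ , y∈ , xy∈) (_ , y′∈ , xy′∈) → _ , L.∘∈ y∈ y′∈ , H.∘∈ xy∈ xy′∈
    ; ⁻¹∈ = λ (_ , y∈ , xy∈) → _ , L.⁻¹∈ y∈ , H.⁻¹∈ xy∈
    }
    where
      module H = IsSubgroup isH
      module L = IsSubgroup isL

  π₂ : Subgroup G₁ a → Subgroup (G₁ ⊗ G₂) (a , b) → Subgroup G₂ b
  π₂ (K , isK) (H , isH) = (λ y → Σ[ x ∈ End G₁ a ] (K x × H (x , y))) , record
    { id∈ = _ , K.id∈ , H.id∈
    ; ∘∈  = λ (_ , x∈ , xy∈) (_ , x′∈ , x′y∈) → _ , K.∘∈ x∈ x′∈ , H.∘∈ xy∈ x′y∈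
    ; ⁻¹∈ = λ (_ , x∈ , xy∈) → _ , K.⁻¹∈ x∈ , H.⁻¹∈ xy∈
    }
    where
      module H = IsSubgroup isH
      module K = IsSubgroup isK

⊸⊥-×ˢ : {A B : GpdOps} {𝒜 : KitPred A} {ℬ : KitPred B}
         {a : GpdOps.Obj A} {b : GpdOps.Obj B}
         {K : Subgroup A a} {L : Subgroup (op B) b} →
         𝒜 a K → (ℬ ⊥) b L → ((𝒜 ⊸ ℬ) ⊥) (a , b) (K ×ˢ L)
⊸⊥-×ˢ {K = K} {L} K∈ L⊥ℬ H H∈ (x , y) xy∈H (x∈K , y∈L) =
  let (forward , backward) = H∈ x y xy∈H
      (K′ , K′⊥𝒜 , x∈K′)  = backward (L , L⊥ℬ , y∈L)
      (L′ , L′∈ , y∈L′)    = forward (K , K∈ , x∈K)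
  in  cong₂ _,_ (K′⊥𝒜 K K∈ x x∈K x∈K′) (L⊥ℬ L′ L′∈ y y∈L′ y∈L)

⊸-isBoolean : {A B : GpdOps} {𝒜 : KitPred A} {ℬ : KitPred B} →
              IsBoolean ℬ → IsBoolean (𝒜 ⊸ ℬ)
⊸-isBoolean {A} {B} {𝒜} {ℬ} ℬ-boolean (a , b) H =
  mk⇔ (⊆-⊥⊥ (𝒜 ⊸ ℬ) (a , b) H) ⊥⊥⊆
  where
    ⊥⊥⊆ : ((𝒜 ⊸ ℬ) ⊥ ⊥) (a , b) H → (𝒜 ⊸ ℬ) (a , b) H
    ⊥⊥⊆ H∈⊥⊥ α β αβ∈H = forward , backward
      where
        H-meets-×ˢ : ∀ {K : Subgroup A a} {L : Subgroup (op B) b} {x y} →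
                     𝒜 a K → (ℬ ⊥) b L →
                     proj₁ K x → proj₁ L y → proj₁ H (x , y) →
                     (x , y) ≡ GpdOps.id (op A ⊗ B) {a , b}
        H-meets-×ˢ {K} {L} K∈ L⊥ℬ x∈K y∈L xy∈H =
          H∈⊥⊥ (K ×ˢ L) (⊸⊥-×ˢ {A} {B} {𝒜} {ℬ} {L = L} K∈ L⊥ℬ) _ (x∈K , y∈L) xy∈H

        forward : ⋃ A 𝒜 a α → ⋃ B ℬ b β
        forward (K , K∈ , α∈K) =
          π₂ (opˢ K) H , Equivalence.from (ℬ-boolean b _) π₂∈ℬ⊥⊥ , (α , α∈K , αβ∈H)
          where
            π₂∈ℬ⊥⊥ : ((ℬ ⊥) ⊥) b (π₂ (opˢ K) H)
            π₂∈ℬ⊥⊥ L L⊥ℬ y y∈L (x , x∈K , xy∈H) =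
              cong proj₂ (H-meets-×ˢ {L = L} K∈ L⊥ℬ x∈K y∈L xy∈H)

        backward : ⋃ (op B) (ℬ ⊥) b β → ⋃ (op A) (𝒜 ⊥) a α
        backward (L , L⊥ℬ , β∈L) = π₁ H (opˢ L) , π₁⊥𝒜 , (β , β∈L , αβ∈H)
          where
            π₁⊥𝒜 : (𝒜 ⊥) a (π₁ H (opˢ L))
            π₁⊥𝒜 K K∈ x x∈K (y , y∈L , xy∈H) =
              cong proj₁ (H-meets-×ˢ {L = L} K∈ L⊥ℬ x∈K y∈L xy∈H)

lemma5p1 : (𝔸 𝔹 : Groupoid) →
    (𝒜 : KitPred (Groupoid.ops 𝔸)) (ℬ : KitPred (Groupoid.ops 𝔹)) →
    IsBooleanKit 𝒜 → IsBooleanKit ℬ →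
    IsBooleanKit (𝒜 ⊸ ℬ)
lemma5p1 𝔸 𝔹 𝒜 ℬ (𝒜-kit , _) (ℬ-kit , ℬ-boolean) =
    ⊸-isKit (Groupoid.isGroupoid 𝔸) (Groupoid.isGroupoid 𝔹) 𝒜-kit ℬ-kit
  , ⊸-isBoolean ℬ-boolean
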